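{- Let $b>2$ be an integer, and let $x, y, \alpha, \beta$ be nonnegative integers such that $$b^x-b^y=2^\alpha 3^\beta.$$ Then one of the following holds: (i) $b=2^\alpha 3^\beta+1$, $x=1$, $y=0$; (ii) $b=3$, $x=y+1$, $\beta=y$, $\alpha=1$; (iii) $b=3$, $x=y+2$, $\beta=y$, $\alpha=3$; (iv) $b=9$, $x=y+1$, $\beta=2y$, $\alpha=3$; (v) $b=4$, $x=y+1$, $\alpha=2y$, $\beta=1$; (vi) $y=0$ and $(b,x,\alpha,\beta)\in\{(2,2,0,1),(5,2,3,1),(7,2,4,1),(17,2,5,2)\}$. -}

module Defs where

{-# OPTIONS --safe #-}
-- Write x = y + k with k ≥ 1 and b ^ k = 1 + N, so that b ^ y * N = 2 ^ α * 3 ^ β.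
-- The backbone is the list of consecutive 3-smooth numbers, (1,2), (2,3), (3,4), (8,9): one of the two
-- is a power of 2 and the other a power of 3, and 1 + 3 ^ j = 2 ^ i, 1 + 2 ^ i = 3 ^ j are solved
-- modulo 8 (for even j after factoring 3 ^ j − 1).
-- If y > 0 then b is 3-smooth as well, so N and b ^ k are consecutive 3-smooth numbers.
-- If y = 0 and k ≥ 2, then N = b ^ k − 1 is 3-smooth. For k = 2m, N = u (u + 2) with u = b ^ m − 1, and
-- the consecutive pairs (applied to u/2, u/2 + 1) give b ^ m ∈ {3, 5, 7, 17}; these are prime, so m = 1.
-- For odd k the odd factor 1 + b + ⋯ + b ^ (k − 1) of N is a power of 3 and at least 9. Modulo 3 this
-- forces 3 ∣ k, and then the same applies to the cube (b ^ (k / 3)) ^ 3, whose factor 1 + c + c ^ 2 is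
-- never divisible by 9.
module Submission where

open import Defs
open import Data.Nat using (ℕ; _+_; _*_; _^_; _<_)
open import Data.Sum using (_⊎_)
open import Data.Product using (_×_)
open import Relation.Binary.PropositionalEquality using (_≡_)

open import Data.Nat.Properties
open import Algebra.Properties.CommutativeSemigroup *-commutativeSemigroup
  using (interchange; x∙yz≈y∙xz; xy∙z≈y∙xz; x∙yz≈z∙xy)
open import Data.Empty using (⊥; ⊥-elim)
open import Data.Fin using (Fin; toℕ; fromℕ<)
open import Data.Fin.Properties using (all?; toℕ-fromℕ<)
open import Data.List using ([]; _∷_)
open import Data.List.Membership.Propositional using (_∈_)
open import Data.List.Membership.Propositional.Properties using (∈-map⁺)
open import Data.List.Relation.Unary.All as All using (All)
open import Data.List.Relation.Unary.Any using (here; there)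
open import Data.Nat using (zero; suc; pred; _≤_; _>_; _%_; z≤n; s≤s)
open import Data.Nat using (NonZero; NonTrivial; nonTrivial⇒n>1; n>1⇒nonTrivial; nonTrivial⇒≢1)
open import Data.Nat.DivMod
  using (%-distribˡ-+; %-distribˡ-*; m%n%n≡m%n; m%n<n; %-remove-+ʳ; %-pred-≡0; [m+kn]%n≡m%n; [m+n]%n≡m%n)
open import Data.Nat.Divisibility
open import Data.Nat.Primality
  using (Prime; prime?; prime[2]; prime⇒nonZero; euclidsLemma; composite⇒¬prime)
open import Data.Nat.Tactic.RingSolver using (solve-∀)
open import Data.Product using (∃; ∃₂; _,_)
open import Data.Sum using (inj₁; inj₂)
open import Relation.Binary.Definitions using (tri<; tri≈; tri>)
open import Relation.Binary.PropositionalEquality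
  using (_≢_; refl; sym; trans; cong; cong₂; subst; module ≡-Reasoning)
open import Relation.Nullary using (¬_; contradiction; yes; no; ¬?)
open import Relation.Nullary.Decidable using (from-yes)

module _ {d : ℕ} .{{_ : NonZero d}} where

  %-cong-+ : ∀ {m m′ n n′} → m % d ≡ m′ % d → n % d ≡ n′ % d → (m + n) % d ≡ (m′ + n′) % d
  %-cong-+ {m} {m′} {n} {n′} m≡m′ n≡n′ = begin
    (m + n) % d            ≡⟨ %-distribˡ-+ m n d ⟩
    (m % d + n % d) % d    ≡⟨ cong₂ (λ a c → (a + c) % d) m≡m′ n≡n′ ⟩
    (m′ % d + n′ % d) % d  ≡⟨ %-distribˡ-+ m′ n′ d ⟨
    (m′ + n′) % d          ∎
    where open ≡-Reasoning

  %-cong-* : ∀ {m m′ n n′} → m % d ≡ m′ % d → n % d ≡ n′ % d → (m * n) % d ≡ (m′ * n′) % d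
  %-cong-* {m} {m′} {n} {n′} m≡m′ n≡n′ = begin
    (m * n) % d              ≡⟨ %-distribˡ-* m n d ⟩
    (m % d * (n % d)) % d    ≡⟨ cong₂ (λ a c → (a * c) % d) m≡m′ n≡n′ ⟩
    (m′ % d * (n′ % d)) % d  ≡⟨ %-distribˡ-* m′ n′ d ⟨
    (m′ * n′) % d            ∎
    where open ≡-Reasoning

  %-cong-^ : ∀ {m m′} n → m % d ≡ m′ % d → m ^ n % d ≡ m′ ^ n % d
  %-cong-^ zero    _     = refl
  %-cong-^ (suc n) m≡m′ = %-cong-* m≡m′ (%-cong-^ n m≡m′)

data EvenOrOdd : ℕ → Set where
  even : ∀ m → EvenOrOdd (2 * m)
  odd  : ∀ m → EvenOrOdd (suc (2 * m))

evenOrOdd : ∀ n → EvenOrOdd n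
evenOrOdd zero = even 0
evenOrOdd (suc n) with evenOrOdd n
... | even m = odd m
... | odd m  = subst EvenOrOdd (*-suc 2 m) (even (suc m))

1+2m%2≡1 : ∀ m → suc (2 * m) % 2 ≡ 1
1+2m%2≡1 m = %-remove-+ʳ 1 {2 * m} {2} (m∣m*n m)

^-double : ∀ m n → m ^ (2 * n) ≡ m ^ n * m ^ n
^-double m n = trans (cong (λ e → m ^ (n + e)) (+-identityʳ n)) (^-distribˡ-+-* m n n)

^-cancelˡ-≡ : ∀ m .{{_ : NonTrivial m}} {n o} → m ^ n ≡ m ^ o → n ≡ o
^-cancelˡ-≡ m {n} {o} eq with <-cmp n o
... | tri< n<o _ _ = contradiction eq (<⇒≢ (^-monoʳ-< m (nonTrivial⇒n>1 m) n<o))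
... | tri≈ _ n≡o _ = n≡o
... | tri> _ _ o<n = contradiction (sym eq) (<⇒≢ (^-monoʳ-< m (nonTrivial⇒n>1 m) o<n))

^-cancelʳ-≡ : ∀ n .{{_ : NonZero n}} {m o} → m ^ n ≡ o ^ n → m ≡ o
^-cancelʳ-≡ n {m} {o} eq with <-cmp m o
... | tri< m<o _ _ = contradiction eq (<⇒≢ (^-monoˡ-< n m<o))
... | tri≈ _ m≡o _ = m≡o
... | tri> _ _ o<m = contradiction (sym eq) (<⇒≢ (^-monoˡ-< n o<m))

m≤n⇒m≤n^[1+o] : ∀ {m n} o → m ≤ n → m ≤ n ^ suc o
m≤n⇒m≤n^[1+o] {n = zero}      _ z≤n = z≤n
m≤n⇒m≤n^[1+o] {n = n@(suc _)} o m≤n = ≤-trans m≤n (m≤m*n n (n ^ o) {{m^n≢0 n o}})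

9≤b^[2+n] : ∀ {b} n → 3 ≤ b → 9 ≤ b ^ (2 + n)
9≤b^[2+n] n 3≤b = *-mono-≤ 3≤b (m≤n⇒m≤n^[1+o] n 3≤b)

∣n⇒∤1+n : ∀ {d n} .{{_ : NonTrivial d}} → d ∣ n → ¬ d ∣ suc n
∣n⇒∤1+n {d} {n} d∣n d∣1+n = nonTrivial⇒≢1 (∣1⇒≡1 (∣m+n∣m⇒∣n (subst (d ∣_) (+-comm 1 n) d∣1+n) d∣n))

¬prime[m*n] : ∀ {m n} → 1 < m → 1 < n → ¬ Prime (m * n)
¬prime[m*n] {m@(suc _)} {n} 1<m 1<n =
  composite⇒¬prime (hasNonTrivialDivisor {{n>1⇒nonTrivial 1<m}} (m<m*n m n 1<n) (m∣m*n n))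

3^[2m]%8≡1 : ∀ m → 3 ^ (2 * m) % 8 ≡ 1
3^[2m]%8≡1 m = begin
  3 ^ (2 * m) % 8  ≡⟨ cong (_% 8) (^-*-assoc 3 2 m) ⟨
  9 ^ m % 8        ≡⟨ %-cong-^ {m′ = 1} m refl ⟩
  1 ^ m % 8        ≡⟨ cong (_% 8) (^-zeroˡ m) ⟩
  1                ∎
  where open ≡-Reasoning

3^[1+2m]%8≡3 : ∀ m → 3 ^ suc (2 * m) % 8 ≡ 3
3^[1+2m]%8≡3 m = %-cong-* {m = 3} {3} {3 ^ (2 * m)} {1} refl (3^[2m]%8≡1 m)

3^j%8 : ∀ j → 3 ^ j % 8 ≡ 1 ⊎ 3 ^ j % 8 ≡ 3
3^j%8 j with evenOrOdd j
... | even m = inj₁ (3^[2m]%8≡1 m)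
... | odd m  = inj₂ (3^[1+2m]%8≡3 m)

8∣2^[3+i] : ∀ i → 8 ∣ 2 ^ (3 + i)
8∣2^[3+i] i = divides (2 ^ i) (trans (^-distribˡ-+-* 2 3 i) (*-comm 8 (2 ^ i)))

2∤3^j : ∀ j → ¬ 2 ∣ 3 ^ j
2∤3^j j 2∣3^j = contradiction (trans (sym (n∣m⇒m%n≡0 _ 2 2∣3^j)) 3^j%2≡1) λ ()
  where
  3^j%2≡1 : 3 ^ j % 2 ≡ 1
  3^j%2≡1 = trans (%-cong-^ {m′ = 1} j refl) (cong (_% 2) (^-zeroˡ j))

3-Smooth : ℕ → Set
3-Smooth n = ∃₂ λ i j → n ≡ 2 ^ i * 3 ^ j

2^i*3^j>0 : ∀ i j → 2 ^ i * 3 ^ j > 0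
2^i*3^j>0 i j = *-mono-≤ (m^n>0 2 i) (m^n>0 3 j)

¬3-smooth[0] : ¬ 3-Smooth 0
¬3-smooth[0] (i , j , eq) = <⇒≢ (2^i*3^j>0 i j) eq

3-smooth-* : ∀ {m n} → 3-Smooth m → 3-Smooth n → 3-Smooth (m * n)
3-smooth-* (a , b , refl) (c , e , refl) = a + c , b + e , (begin
  2 ^ a * 3 ^ b * (2 ^ c * 3 ^ e)  ≡⟨ interchange (2 ^ a) (3 ^ b) (2 ^ c) (3 ^ e) ⟩
  2 ^ a * 2 ^ c * (3 ^ b * 3 ^ e)  ≡⟨ cong₂ _*_ (^-distribˡ-+-* 2 a c) (^-distribˡ-+-* 3 b e) ⟨
  2 ^ (a + c) * 3 ^ (b + e)        ∎)
  where open ≡-Reasoning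

3-smooth-^ : ∀ {m} k → 3-Smooth m → 3-Smooth (m ^ k)
3-smooth-^ zero    _  = 0 , 0 , refl
3-smooth-^ (suc k) sm = 3-smooth-* sm (3-smooth-^ k sm)

∣p*n⇒∣n⊎≡p* : ∀ {p d} n → Prime p → d ∣ p * n → d ∣ n ⊎ ∃ λ e → d ≡ p * e × e ∣ n
∣p*n⇒∣n⊎≡p* {p} {d} n pr (divides q pn≡qd)
  with euclidsLemma q d pr (divides n (trans (sym pn≡qd) (*-comm p n)))
... | inj₁ (divides q′ refl) =
  inj₁ (divides q′ (*-cancelˡ-≡ n (q′ * d) p {{prime⇒nonZero pr}} (trans pn≡qd (xy∙z≈y∙xz q′ p d))))
... | inj₂ (divides e refl) =
  inj₂ (e , *-comm e p ,
        divides q (*-cancelˡ-≡ n (q * e) p {{prime⇒nonZero pr}} (trans pn≡qd (x∙yz≈z∙xy q e p))))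

3-smooth-∣ : ∀ {d n} → d ∣ n → 3-Smooth n → 3-Smooth d
3-smooth-∣ d∣n (i , j , refl) = ∣2^i*3^j⇒3-smooth i j d∣n
  where
  ∣2^i*3^j⇒3-smooth : ∀ {d} i j → d ∣ 2 ^ i * 3 ^ j → 3-Smooth d
  ∣2^i*3^j⇒3-smooth zero zero d∣1 = 0 , 0 , ∣1⇒≡1 d∣1
  ∣2^i*3^j⇒3-smooth {d} zero (suc j) d∣
    with ∣p*n⇒∣n⊎≡p* (1 * 3 ^ j) (from-yes (prime? 3)) (subst (d ∣_) (x∙yz≈y∙xz 1 3 (3 ^ j)) d∣)
  ... | inj₁ d∣n = ∣2^i*3^j⇒3-smooth zero j d∣n
  ... | inj₂ (e , refl , e∣n) with ∣2^i*3^j⇒3-smooth zero j e∣n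
  ...   | a , b , refl = a , suc b , x∙yz≈y∙xz 3 (2 ^ a) (3 ^ b)
  ∣2^i*3^j⇒3-smooth {d} (suc i) j d∣
    with ∣p*n⇒∣n⊎≡p* (2 ^ i * 3 ^ j) prime[2] (subst (d ∣_) (*-assoc 2 (2 ^ i) (3 ^ j)) d∣)
  ... | inj₁ d∣n = ∣2^i*3^j⇒3-smooth i j d∣n
  ... | inj₂ (e , refl , e∣n) with ∣2^i*3^j⇒3-smooth i j e∣n
  ...   | a , b , refl = suc a , b , sym (*-assoc 2 (2 ^ a) (3 ^ b))

3-smooth∧2∤⇒pow3 : ∀ {n} → 3-Smooth n → ¬ 2 ∣ n → ∃ λ j → n ≡ 3 ^ j
3-smooth∧2∤⇒pow3 (zero  , j , refl) _   = j , *-identityˡ (3 ^ j)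
3-smooth∧2∤⇒pow3 (suc i , j , refl) 2∤n = contradiction (∣m⇒∣m*n (3 ^ j) (m∣m*n (2 ^ i))) 2∤n

3-smooth∧3∤⇒pow2 : ∀ {n} → 3-Smooth n → ¬ 3 ∣ n → ∃ λ i → n ≡ 2 ^ i
3-smooth∧3∤⇒pow2 (i , zero  , refl) _   = i , *-identityʳ (2 ^ i)
3-smooth∧3∤⇒pow2 (i , suc j , refl) 3∤n = contradiction (∣n⇒∣m*n (2 ^ i) (m∣m*n (3 ^ j))) 3∤n

3-smooth-unique : ∀ a b c e → 2 ^ a * 3 ^ b ≡ 2 ^ c * 3 ^ e → a ≡ c × b ≡ e
3-smooth-unique zero b zero e eq = refl , ^-cancelˡ-≡ 3 (*-cancelˡ-≡ (3 ^ b) (3 ^ e) 1 eq)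
3-smooth-unique (suc a) b (suc c) e eq
  with 3-smooth-unique a b c e
         (*-cancelˡ-≡ _ _ 2 (trans (sym (*-assoc 2 (2 ^ a) (3 ^ b))) (trans eq (*-assoc 2 (2 ^ c) (3 ^ e)))))
... | refl , refl = refl , refl
3-smooth-unique (suc a) b zero e eq =
  contradiction (subst (2 ∣_) (trans eq (*-identityˡ (3 ^ e))) (∣m⇒∣m*n (3 ^ b) (m∣m*n (2 ^ a))))
                (2∤3^j e)
3-smooth-unique zero b (suc c) e eq =
  contradiction (subst (2 ∣_) (trans (sym eq) (*-identityˡ (3 ^ b))) (∣m⇒∣m*n (3 ^ e) (m∣m*n (2 ^ c))))
                (2∤3^j b)

8∤1+3^j : ∀ j → ¬ 8 ∣ 1 + 3 ^ j
8∤1+3^j j 8∣1+3^j with 3^j%8 j | %-pred-≡0 {3 ^ j} {8} (n∣m⇒m%n≡0 _ 8 8∣1+3^j)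
... | inj₁ r | r′ = contradiction (trans (sym r) r′) λ ()
... | inj₂ r | r′ = contradiction (trans (sym r) r′) λ ()

suc-square : ∀ s → suc s * suc s ≡ suc (s * (2 + s))
suc-square = solve-∀

square≡suc⇒suc∣ : ∀ {t n} → t * t ≡ suc n → suc t ∣ n
square≡suc⇒suc∣ {suc s} eq = divides s (suc-injective (trans (sym eq) (suc-square s)))

1+3^j≡2^i⇒ : ∀ i j → 1 + 3 ^ j ≡ 2 ^ i → (i ≡ 1 × j ≡ 0) ⊎ (i ≡ 2 × j ≡ 1)
1+3^j≡2^i⇒ 0 j eq = contradiction (m^n≡0⇒m≡0 3 j (suc-injective eq)) λ ()
1+3^j≡2^i⇒ 1 j eq with m^n≡1⇒n≡0∨m≡1 3 j (suc-injective eq)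
... | inj₁ j≡0 = inj₁ (refl , j≡0)
1+3^j≡2^i⇒ 2 j eq = inj₂ (refl , ^-cancelˡ-≡ 3 (suc-injective eq))
1+3^j≡2^i⇒ (suc (suc (suc i))) j eq = contradiction (subst (8 ∣_) (sym eq) (8∣2^[3+i] i)) (8∤1+3^j j)

-- 2 ^ i = (3 ^ m − 1) (3 ^ m + 1), so 3 ^ m + 1 is a power of 2.
1+2^i≡3^[2m]⇒ : ∀ i m → 1 + 2 ^ i ≡ 3 ^ (2 * m) → i ≡ 3 × m ≡ 1
1+2^i≡3^[2m]⇒ i zero eq = contradiction (m^n≡0⇒m≡0 2 i (suc-injective eq)) λ ()
1+2^i≡3^[2m]⇒ i (suc m) eq
  with 3-smooth∧3∤⇒pow2 (3-smooth-∣ (square≡suc⇒suc∣ (trans (sym (^-double 3 (suc m))) (sym eq)))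
                                    (i , 0 , sym (*-identityʳ (2 ^ i))))
                        (∣n⇒∤1+n (m∣m*n (3 ^ m)))
... | a , 1+3^[1+m]≡2^a with 1+3^j≡2^i⇒ a (suc m) 1+3^[1+m]≡2^a
...   | inj₂ (_ , refl) = ^-cancelˡ-≡ 2 (suc-injective eq) , refl

1+2^i≡3^j⇒ : ∀ i j → 1 + 2 ^ i ≡ 3 ^ j → (i ≡ 1 × j ≡ 1) ⊎ (i ≡ 3 × j ≡ 2)
1+2^i≡3^j⇒ 0 j eq = contradiction (subst (2 ∣_) eq ∣-refl) (2∤3^j j)
1+2^i≡3^j⇒ 1 j eq = inj₁ (refl , sym (^-cancelˡ-≡ 3 eq))
1+2^i≡3^j⇒ 2 j eq with 3^j%8 j
... | inj₁ r = contradiction (trans (cong (_% 8) eq) r) λ ()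
... | inj₂ r = contradiction (trans (cong (_% 8) eq) r) λ ()
1+2^i≡3^j⇒ (suc (suc (suc i))) j eq with evenOrOdd j
... | even m with 1+2^i≡3^[2m]⇒ (3 + i) m eq
...   | refl , refl = inj₂ (refl , refl)
1+2^i≡3^j⇒ (suc (suc (suc i))) j eq | odd m =
  contradiction (trans (sym (%-remove-+ʳ 1 (8∣2^[3+i] i))) (trans (cong (_% 8) eq) (3^[1+2m]%8≡3 m)))
                λ ()

consecutive-3-smooth : ∀ {n} → 3-Smooth n → 3-Smooth (suc n) → n ∈ 1 ∷ 2 ∷ 3 ∷ 8 ∷ []
consecutive-3-smooth {n} sn s1+n with 2 ∣? n
... | no 2∤n with 3-smooth∧2∤⇒pow3 sn 2∤n
...   | zero  , refl = here refl
...   | suc j , refl with 3-smooth∧3∤⇒pow2 s1+n (∣n⇒∤1+n (m∣m*n (3 ^ j)))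
...     | i , 1+n≡2^i with 1+3^j≡2^i⇒ i (suc j) 1+n≡2^i
...       | inj₂ (_ , refl) = there (there (here refl))
consecutive-3-smooth {n} sn s1+n | yes 2∣n with 3-smooth∧2∤⇒pow3 s1+n (∣n⇒∤1+n 2∣n)
... | zero  , 1+n≡1 = contradiction (subst 3-Smooth (suc-injective 1+n≡1) sn) ¬3-smooth[0]
... | suc j , 1+n≡3^[1+j]
  with 3-smooth∧3∤⇒pow2 sn (λ 3∣n → ∣n⇒∤1+n 3∣n (subst (3 ∣_) (sym 1+n≡3^[1+j]) (m∣m*n (3 ^ j))))
...   | i , refl with 1+2^i≡3^j⇒ i (suc j) 1+n≡3^[1+j]
...     | inj₁ (refl , _) = there (here refl)
...     | inj₂ (refl , _) = there (there (there (here refl)))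

-- For u = 2w the product is 4 w (w + 1); for odd u, both u and u + 2 would be powers of 3.
u[2+u]-3-smooth : ∀ {u} → 2 ≤ u → 3-Smooth (u * (2 + u)) → u ∈ 2 ∷ 4 ∷ 6 ∷ 16 ∷ []
u[2+u]-3-smooth {u} 2≤u s with 2 ∣? u
... | yes (divides w refl) =
  ∈-map⁺ (_* 2) (consecutive-3-smooth (3-smooth-∣ (m∣m*n (suc w)) sw) (3-smooth-∣ (n∣m*n w) sw))
  where
  factor : ∀ w → w * 2 * (2 + w * 2) ≡ 4 * (w * suc w)
  factor = solve-∀
  sw : 3-Smooth (w * suc w)
  sw = 3-smooth-∣ (divides 4 (factor w)) s
... | no 2∤u with 3-smooth∧2∤⇒pow3 (3-smooth-∣ (m∣m*n (2 + u)) s) 2∤u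
...   | zero  , refl = contradiction 2≤u λ { (s≤s ()) }
...   | suc a , refl
  with 3-smooth∧2∤⇒pow3 (3-smooth-∣ (n∣m*n (3 ^ suc a)) s) (λ 2∣2+u → 2∤u (∣m+n∣m⇒∣n 2∣2+u ∣-refl))
...     | suc c , 2+u≡3^[1+c] =
  contradiction (∣m+n∣m⇒∣n (subst (3 ∣_) (trans (sym 2+u≡3^[1+c]) (+-comm 2 _)) (m∣m*n (3 ^ c)))
                           (m∣m*n (3 ^ a)))
                (>⇒∤ ≤-refl)

3-smooth-pred-square : ∀ {t N} → 3 ≤ t → 3-Smooth N → t * t ≡ suc N → t ∈ 3 ∷ 5 ∷ 7 ∷ 17 ∷ []
3-smooth-pred-square {suc u} (s≤s 2≤u) sN eq =
  ∈-map⁺ suc (u[2+u]-3-smooth 2≤u (subst 3-Smooth (suc-injective (trans (sym eq) (suc-square u))) sN))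

repunit : ℕ → ℕ → ℕ
repunit b zero    = 0
repunit b (suc k) = 1 + b * repunit b k

%-cong-repunit : ∀ {d} .{{_ : NonZero d}} {b b′} k → b % d ≡ b′ % d → repunit b k % d ≡ repunit b′ k % d
%-cong-repunit zero    _     = refl
%-cong-repunit (suc k) b≡b′ = %-cong-+ {m = 1} {m′ = 1} refl (%-cong-* b≡b′ (%-cong-repunit k b≡b′))

repunit-pow : ∀ c k → suc c ^ k ≡ 1 + c * repunit (suc c) k
repunit-pow c zero    = cong suc (sym (*-zeroʳ c))
repunit-pow c (suc k) = trans (cong (suc c *_) (repunit-pow c k)) (step c (repunit (suc c) k))
  where
  step : ∀ c r → suc c * (1 + c * r) ≡ 1 + c * (1 + suc c * r)
  step = solve-∀

repunit-1 : ∀ k → repunit 1 k ≡ k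
repunit-1 zero    = refl
repunit-1 (suc k) = cong suc (trans (*-identityˡ (repunit 1 k)) (repunit-1 k))

repunit[2,k]%3≡k%2 : ∀ k → repunit 2 k % 3 ≡ k % 2
repunit[2,k]%3≡k%2 0 = refl
repunit[2,k]%3≡k%2 1 = refl
repunit[2,k]%3≡k%2 (suc (suc k)) = begin
  repunit 2 (2 + k) % 3  ≡⟨ cong (_% 3) (step r) ⟩
  (r + (1 + r) * 3) % 3  ≡⟨ [m+kn]%n≡m%n r (1 + r) 3 ⟩
  r % 3                  ≡⟨ repunit[2,k]%3≡k%2 k ⟩
  k % 2                  ≡⟨ [m+n]%n≡m%n k 2 ⟨
  (k + 2) % 2            ≡⟨ cong (_% 2) (+-comm k 2) ⟩
  (2 + k) % 2            ∎
  where
  open ≡-Reasoning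
  r = repunit 2 k
  step : ∀ r → 1 + 2 * (1 + 2 * r) ≡ r + (1 + r) * 3
  step = solve-∀

repunit-odd : ∀ b m → ¬ 2 ∣ repunit b (suc (2 * m))
repunit-odd b m 2∣R = contradiction (trans (sym (n∣m⇒m%n≡0 _ 2 2∣R)) R%2≡1) λ ()
  where
  k = suc (2 * m)
  by-residue : ∀ r → r < 2 → repunit r k % 2 ≡ 1
  by-residue 0 _ = refl
  by-residue 1 _ = trans (cong (_% 2) (repunit-1 k)) (1+2m%2≡1 m)
  by-residue (suc (suc _)) (s≤s (s≤s ()))
  R%2≡1 : repunit b k % 2 ≡ 1
  R%2≡1 = trans (%-cong-repunit {2} {b} {b % 2} k (sym (m%n%n≡m%n b 2))) (by-residue (b % 2) (m%n<n b 2))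

3∣repunit⇒3∣k : ∀ b m → 3 ∣ repunit b (suc (2 * m)) → 3 ∣ suc (2 * m)
3∣repunit⇒3∣k b m 3∣R =
  m%n≡0⇒n∣m k 3 (by-residue (b % 3) (m%n<n b 3)
                  (trans (%-cong-repunit {3} {b % 3} {b} k (m%n%n≡m%n b 3)) (n∣m⇒m%n≡0 _ 3 3∣R)))
  where
  k = suc (2 * m)
  by-residue : ∀ r → r < 3 → repunit r k % 3 ≡ 0 → k % 3 ≡ 0
  by-residue 0 _ ()
  by-residue 1 _ R%3≡0 = trans (cong (_% 3) (sym (repunit-1 k))) R%3≡0
  by-residue 2 _ R%3≡0 =
    contradiction (trans (sym (1+2m%2≡1 m)) (trans (sym (repunit[2,k]%3≡k%2 k)) R%3≡0)) λ ()
  by-residue (suc (suc (suc _))) (s≤s (s≤s (s≤s ())))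

9∤repunit[b,3] : ∀ b → ¬ 9 ∣ repunit b 3
9∤repunit[b,3] b 9∣R = by-residue (fromℕ< (m%n<n b 9)) R%9≡0
  where
  by-residue : ∀ (r : Fin 9) → repunit (toℕ r) 3 % 9 ≢ 0
  by-residue = from-yes (all? {n = 9} λ r → ¬? (repunit (toℕ r) 3 % 9 ≟ 0))
  R%9≡0 : repunit (toℕ (fromℕ< (m%n<n b 9))) 3 % 9 ≡ 0
  R%9≡0 = trans (cong (λ r → repunit r 3 % 9) (toℕ-fromℕ< (m%n<n b 9)))
                (trans (%-cong-repunit {9} {b % 9} {b} 3 (m%n%n≡m%n b 9)) (n∣m⇒m%n≡0 _ 9 9∣R))

9∣3^j : ∀ j → 4 ≤ 3 ^ j → 9 ∣ 3 ^ j
9∣3^j zero (s≤s ())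
9∣3^j (suc zero) (s≤s (s≤s (s≤s ())))
9∣3^j (suc (suc j)) _ = subst (9 ∣_) (*-assoc 3 3 (3 ^ j)) (m∣m*n (3 ^ j))

9∣repunit : ∀ {b N} m → 3 ≤ b → 3-Smooth N → b ^ suc (2 * suc m) ≡ suc N →
            9 ∣ repunit b (suc (2 * suc m))
9∣repunit {suc c} {N} m (s≤s 2≤c) sN eq =
  let j , R≡3^j = 3-smooth∧2∤⇒pow3 (3-smooth-∣ R∣N sN) (repunit-odd (suc c) (suc m))
  in subst (9 ∣_) (sym R≡3^j) (9∣3^j j (subst (4 ≤_) R≡3^j 4≤R))
  where
  R∣N : repunit (suc c) (suc (2 * suc m)) ∣ N
  R∣N = divides c (suc-injective (trans (sym eq) (repunit-pow c (suc (2 * suc m)))))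
  4≤R : 4 ≤ repunit (suc c) (suc (2 * suc m))
  4≤R = s≤s (≤-trans (s≤s 2≤c) (m≤m*n (suc c) _))

3-smooth-pred-odd-power : ∀ {b N} m → 3 ≤ b → 3-Smooth N → b ^ suc (2 * suc m) ≡ suc N → ⊥
3-smooth-pred-odd-power {b} m 3≤b sN eq =
  cube-case (3∣repunit⇒3∣k b (suc m) (∣-trans (divides 3 refl) (9∣repunit m 3≤b sN eq)))
  where
  cube-case : 3 ∣ suc (2 * suc m) → ⊥
  cube-case (divides (suc n) k≡[1+n]*3) =
    9∤repunit[b,3] (b ^ suc n) (9∣repunit 0 (m≤n⇒m≤n^[1+o] n 3≤b) sN
      (trans (^-*-assoc b (suc n) 3) (trans (cong (b ^_) (sym k≡[1+n]*3)) eq)))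

3-5-7-17-prime : All Prime (3 ∷ 5 ∷ 7 ∷ 17 ∷ [])
3-5-7-17-prime = from-yes (All.all? prime? (3 ∷ 5 ∷ 7 ∷ 17 ∷ []))

3-smooth-pred-even-power : ∀ {b N} m → 3 ≤ b → 3-Smooth N → b ^ (2 * suc m) ≡ suc N →
                           m ≡ 0 × b ∈ 3 ∷ 5 ∷ 7 ∷ 17 ∷ []
3-smooth-pred-even-power {b} m 3≤b sN eq =
  by-exponent m (3-smooth-pred-square (m≤n⇒m≤n^[1+o] m 3≤b) sN (trans (sym (^-double b (suc m))) eq))
  where
  1<b : 1 < b
  1<b = ≤-trans (n≤1+n 2) 3≤b
  by-exponent : ∀ m → b ^ suc m ∈ 3 ∷ 5 ∷ 7 ∷ 17 ∷ [] → m ≡ 0 × b ∈ 3 ∷ 5 ∷ 7 ∷ 17 ∷ []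
  by-exponent zero    b∈ = refl , subst (_∈ _) (*-identityʳ b) b∈
  by-exponent (suc m) b^[2+m]∈ =
    contradiction (All.lookup 3-5-7-17-prime b^[2+m]∈) (¬prime[m*n] 1<b (m≤n⇒m≤n^[1+o] m 1<b))

3-smooth-pred-power : ∀ {b n N} → 3 ≤ b → 2 ≤ n → 3-Smooth N → b ^ n ≡ suc N →
                      n ≡ 2 × b ∈ 3 ∷ 5 ∷ 7 ∷ 17 ∷ []
3-smooth-pred-power {n = n} 3≤b 2≤n sN eq with evenOrOdd n
... | even zero    = contradiction 2≤n λ ()
... | odd zero     = contradiction 2≤n λ { (s≤s ()) }
... | odd (suc m)  = ⊥-elim (3-smooth-pred-odd-power m 3≤b sN eq)
... | even (suc m) with 3-smooth-pred-even-power m 3≤b sN eq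
...   | refl , b∈ = refl , b∈

8≤n∈1∷2∷3∷8⇒n≡8 : ∀ {n} → n ∈ 1 ∷ 2 ∷ 3 ∷ 8 ∷ [] → 8 ≤ n → n ≡ 8
8≤n∈1∷2∷3∷8⇒n≡8 (here refl)                         8≤1 = ⊥-elim (≤⇒≤ᵇ 8≤1)
8≤n∈1∷2∷3∷8⇒n≡8 (there (here refl))                 8≤2 = ⊥-elim (≤⇒≤ᵇ 8≤2)
8≤n∈1∷2∷3∷8⇒n≡8 (there (there (here refl)))         8≤3 = ⊥-elim (≤⇒≤ᵇ 8≤3)
8≤n∈1∷2∷3∷8⇒n≡8 (there (there (there (here refl)))) _   = refl

power-among-2-3-4-9 : ∀ {b k N} → 3 ≤ b → N ∈ 1 ∷ 2 ∷ 3 ∷ 8 ∷ [] → b ^ suc k ≡ suc N →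
    (b ≡ 3 × k ≡ 0 × N ≡ 2) ⊎ (b ≡ 4 × k ≡ 0 × N ≡ 3) ⊎ (b ≡ 3 × k ≡ 1 × N ≡ 8) ⊎ (b ≡ 9 × k ≡ 0 × N ≡ 8)
power-among-2-3-4-9 {b} {zero} 3≤b N∈ eq with trans (sym (*-identityʳ b)) eq | N∈
... | refl | here refl                         = contradiction 3≤b λ { (s≤s (s≤s ())) }
... | refl | there (here refl)                 = inj₁ (refl , refl , refl)
... | refl | there (there (here refl))         = inj₂ (inj₁ (refl , refl , refl))
... | refl | there (there (there (here refl))) = inj₂ (inj₂ (inj₂ (refl , refl , refl)))
power-among-2-3-4-9 {b} {suc k} 3≤b N∈ eq
  with 8≤n∈1∷2∷3∷8⇒n≡8 N∈ (≤-pred (subst (9 ≤_) eq (9≤b^[2+n] k 3≤b)))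
power-among-2-3-4-9 {b} {suc zero} 3≤b N∈ eq | refl = inj₂ (inj₂ (inj₁ (^-cancelʳ-≡ 2 eq , refl , refl)))
power-among-2-3-4-9 {b} {suc (suc k)} 3≤b N∈ eq | refl =
  ⊥-elim (≤⇒≤ᵇ (subst (27 ≤_) eq (*-mono-≤ 3≤b (9≤b^[2+n] k 3≤b))))

ListedSolution : (b x y α β : ℕ) → Set
ListedSolution b x y α β =
    (b ≡ 2 ^ α * 3 ^ β + 1 × x ≡ 1 × y ≡ 0)
    ⊎ (b ≡ 3 × x ≡ y + 1 × β ≡ y × α ≡ 1)
    ⊎ (b ≡ 3 × x ≡ y + 2 × β ≡ y × α ≡ 3)
    ⊎ (b ≡ 9 × x ≡ y + 1 × β ≡ 2 * y × α ≡ 3)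
    ⊎ (b ≡ 4 × x ≡ y + 1 × α ≡ 2 * y × β ≡ 1)
    ⊎ (y ≡ 0 × ((b ≡ 2 × x ≡ 2 × α ≡ 0 × β ≡ 1)
               ⊎ (b ≡ 5 × x ≡ 2 × α ≡ 3 × β ≡ 1)
               ⊎ (b ≡ 7 × x ≡ 2 × α ≡ 4 × β ≡ 1)
               ⊎ (b ≡ 17 × x ≡ 2 × α ≡ 5 × β ≡ 2)))

y≡0-solution : ∀ {b} k {α β} → 3 ≤ b → b ^ suc k ≡ suc (2 ^ α * 3 ^ β) → ListedSolution b (suc k) 0 α β
y≡0-solution {b} zero 3≤b eq = inj₁ (trans (sym (*-identityʳ b)) (trans eq (+-comm 1 _)) , refl , refl)
y≡0-solution (suc k) {α} {β} 3≤b eq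
  with 3-smooth-pred-power {n = suc (suc k)} 3≤b (s≤s (s≤s z≤n)) (α , β , refl) eq
... | refl , here refl
  with 3-smooth-unique α β 3 0 (suc-injective (sym eq))
...   | refl , refl = inj₂ (inj₂ (inj₁ (refl , refl , refl , refl)))
y≡0-solution (suc k) {α} {β} 3≤b eq | refl , there (here refl)
  with 3-smooth-unique α β 3 1 (suc-injective (sym eq))
...   | refl , refl = inj₂ (inj₂ (inj₂ (inj₂ (inj₂ (refl , inj₂ (inj₁ (refl , refl , refl , refl)))))))
y≡0-solution (suc k) {α} {β} 3≤b eq | refl , there (there (here refl))
  with 3-smooth-unique α β 4 1 (suc-injective (sym eq))
...   | refl , refl = inj₂ (inj₂ (inj₂ (inj₂ (inj₂ (refl , inj₂ (inj₂ (inj₁ (refl , refl , refl , refl))))))))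
y≡0-solution (suc k) {α} {β} 3≤b eq | refl , there (there (there (here refl)))
  with 3-smooth-unique α β 5 2 (suc-injective (sym eq))
...   | refl , refl = inj₂ (inj₂ (inj₂ (inj₂ (inj₂ (refl , inj₂ (inj₂ (inj₂ (refl , refl , refl , refl))))))))

y>0-solution : ∀ {b} y k {N α β} → 3 ≤ b → 3-Smooth b → 3-Smooth N → b ^ suc k ≡ suc N →
               b ^ suc y * N ≡ 2 ^ α * 3 ^ β → ListedSolution b (suc y + suc k) (suc y) α β
y>0-solution y k {α = α} {β} 3≤b sb sN eqk eq
  with power-among-2-3-4-9 {k = k} 3≤b (consecutive-3-smooth sN (subst 3-Smooth eqk (3-smooth-^ (suc k) sb)))
                           eqk
... | inj₁ (refl , refl , refl)
  with 3-smooth-unique α β 1 (suc y) (trans (sym eq) (*-comm (3 ^ suc y) 2))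
...   | refl , refl = inj₂ (inj₁ (refl , refl , refl , refl))
y>0-solution y k {α = α} {β} 3≤b sb sN eqk eq | inj₂ (inj₁ (refl , refl , refl))
  with 3-smooth-unique α β (2 * suc y) 1 (trans (sym eq) (cong (_* 3) (^-*-assoc 2 2 (suc y))))
...   | refl , refl = inj₂ (inj₂ (inj₂ (inj₂ (inj₁ (refl , refl , refl , refl)))))
y>0-solution y k {α = α} {β} 3≤b sb sN eqk eq | inj₂ (inj₂ (inj₁ (refl , refl , refl)))
  with 3-smooth-unique α β 3 (suc y) (trans (sym eq) (*-comm (3 ^ suc y) 8))
...   | refl , refl = inj₂ (inj₂ (inj₁ (refl , refl , refl , refl)))
y>0-solution y k {α = α} {β} 3≤b sb sN eqk eq | inj₂ (inj₂ (inj₂ (refl , refl , refl)))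
  with 3-smooth-unique α β 3 (2 * suc y)
         (trans (sym eq) (trans (*-comm (9 ^ suc y) 8) (cong (8 *_) (^-*-assoc 3 2 (suc y)))))
...   | refl , refl = inj₂ (inj₂ (inj₂ (inj₁ (refl , refl , refl , refl))))

b^x≡b^y+n⇒y<x : ∀ b .{{_ : NonZero b}} x y {n} → n > 0 → b ^ x ≡ b ^ y + n → y < x
b^x≡b^y+n⇒y<x b x y n>0 eq =
  ≰⇒> λ x≤y → <⇒≱ (subst (b ^ y <_) (sym eq) (m<m+n (b ^ y) n>0)) (^-monoʳ-≤ b x≤y)

<⇒≡+suc : ∀ {m n} → m < n → ∃ λ k → n ≡ m + suc k
<⇒≡+suc {m} m<n with m≤n⇒∃[o]m+o≡n m<n
... | k , refl = k , sym (+-suc m k)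

b^[y+k]≡b^y+n⇒b^y*N≡n : ∀ b y k {N n} → b ^ k ≡ suc N → b ^ (y + k) ≡ b ^ y + n → b ^ y * N ≡ n
b^[y+k]≡b^y+n⇒b^y*N≡n b y k {N} {n} eqk eq = +-cancelˡ-≡ (b ^ y) _ _ (begin
  b ^ y + b ^ y * N  ≡⟨ *-suc (b ^ y) N ⟨
  b ^ y * suc N      ≡⟨ cong (b ^ y *_) eqk ⟨
  b ^ y * b ^ k      ≡⟨ ^-distribˡ-+-* b y k ⟨
  b ^ (y + k)        ≡⟨ eq ⟩
  b ^ y + n          ∎)
  where open ≡-Reasoning

solution-of-gap : ∀ {b} y k {α β} → 3 ≤ b → b ^ (y + suc k) ≡ b ^ y + 2 ^ α * 3 ^ β →
                  ListedSolution b (y + suc k) y α β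
solution-of-gap zero    k 3≤b eq = y≡0-solution k 3≤b eq
solution-of-gap {b@(suc _)} (suc y) k {α} {β} 3≤b eq = y>0-solution y k 3≤b sb sN eqk eq′
  where
  N = pred (b ^ suc k)
  eqk : b ^ suc k ≡ suc N
  eqk = sym (suc-pred (b ^ suc k) {{m^n≢0 b (suc k)}})
  eq′ : b ^ suc y * N ≡ 2 ^ α * 3 ^ β
  eq′ = b^[y+k]≡b^y+n⇒b^y*N≡n b (suc y) (suc k) eqk eq
  sb : 3-Smooth b
  sb = 3-smooth-∣ (∣m⇒∣m*n N (m∣m*n (b ^ y))) (α , β , eq′)
  sN : 3-Smooth N
  sN = 3-smooth-∣ (n∣m*n (b ^ suc y)) (α , β , eq′)

lemma2p1 : (b x y α β : ℕ) → 2 < b → b ^ x ≡ b ^ y + 2 ^ α * 3 ^ β →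
    (b ≡ 2 ^ α * 3 ^ β + 1 × x ≡ 1 × y ≡ 0)
    ⊎ (b ≡ 3 × x ≡ y + 1 × β ≡ y × α ≡ 1)
    ⊎ (b ≡ 3 × x ≡ y + 2 × β ≡ y × α ≡ 3)
    ⊎ (b ≡ 9 × x ≡ y + 1 × β ≡ 2 * y × α ≡ 3)
    ⊎ (b ≡ 4 × x ≡ y + 1 × α ≡ 2 * y × β ≡ 1)
    ⊎ (y ≡ 0 × ((b ≡ 2 × x ≡ 2 × α ≡ 0 × β ≡ 1)
               ⊎ (b ≡ 5 × x ≡ 2 × α ≡ 3 × β ≡ 1)
               ⊎ (b ≡ 7 × x ≡ 2 × α ≡ 4 × β ≡ 1)
               ⊎ (b ≡ 17 × x ≡ 2 × α ≡ 5 × β ≡ 2)))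
lemma2p1 b@(suc _) x y α β 3≤b eq with <⇒≡+suc (b^x≡b^y+n⇒y<x b x y (2^i*3^j>0 α β) eq)
... | k , refl = solution-of-gap y k 3≤b eq
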